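{- There exists an algorithm that takes as input an integer $k>0$, an unweighted (multi)graph $G$ with $\textsf{cc}(G)<k$, and a real number $0< \epsilon \leq 1$, and outputs a subgraph $G_1$ of $G$ with $V(G_1)=V(G)$ such that $|E(G)|-|E(G_1)|\leq 2\epsilon\cdot \textsf{OPT}(G,k)$. Further, if $\textsf{cc}(G_1)<k$, then each non-trivial $2$-cut of $G_1$ has weight at least $\frac{\epsilon \cdot \textsf{OPT}(G,k)}{k-1}$.
   Context: $\textsf{cc}(G)$ denotes the number of connected components of $G$. A $k$-cut of $G$ is a partition of $V(G)$ into $k$ non-empty parts; its weight (in an unweighted multigraph) is the number of edges, counted with multiplicity, with endpoints in different parts. $\textsf{OPT}(G,k)$ is the minimum weight of a $k$-cut of $G$. A $2$-cut is non-trivial if at least one edge crosses it.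
   Formalization: The input ε is a rational number with 0 < ε ≤ 1 rather than a real number. -}

module Defs where

open import Data.Nat using (ℕ; suc; _<_; _∸_)
open import Data.Fin using (Fin)
open import Data.Fin.Properties using (_≟_)
open import Data.Integer using (+_)
open import Data.Rational using (ℚ; _/_)
open import Data.List using (List; length; filter)
open import Data.Product using (Σ; ∃; ∃-syntax; _×_; _,_)
open import Data.Sum using (_⊎_)
open import Function using (_⇔_)
open import Relation.Nullary using (¬?)
open import Relation.Binary.PropositionalEquality using (_≡_)
open import Data.List.Membership.Propositional renaming (_∈_ to _∈E_)
open import Relation.Binary.Construct.Closure.ReflexiveTransitive using (Star)

-- An unweighted multigraph on vertex set Fin n: a list of edges
-- (pairs of endpoints, repetitions = multiplicity).
record MultiGraph : Set where
  constructor graph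
  field
    n     : ℕ
    edges : List (Fin n × Fin n)
open MultiGraph public

data Adj (G : MultiGraph) : Fin (n G) → Fin (n G) → Set where
  fwd : ∀ {u v} → (u , v) ∈E edges G → Adj G u v
  bwd : ∀ {u v} → (u , v) ∈E edges G → Adj G v u

Connected : (G : MultiGraph) → Fin (n G) → Fin (n G) → Set
Connected G = Star (Adj G)

Surjective : ∀ {a b} → (Fin a → Fin b) → Set
Surjective {b = b} f = (j : Fin b) → ∃[ i ] f i ≡ j

-- cc(G) = m : the connected components are exactly the (non-empty)
-- fibres of a surjective labelling c : V → Fin m.
HasCC : MultiGraph → ℕ → Set
HasCC G m = Σ (Fin (n G) → Fin m) λ c →
  Surjective c × (∀ u v → (c u ≡ c v) ⇔ Connected G u v)

CCLess : MultiGraph → ℕ → Set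
CCLess G k = ∃[ m ] (HasCC G m × m < k)

Cut : MultiGraph → ℕ → Set
Cut G k = Σ (Fin (n G) → Fin k) Surjective

weight : (G : MultiGraph) (k : ℕ) → Cut G k → ℕ
weight (graph n es) k (p , _) =
  length (filter (λ e → ¬? (p (Data.Product.proj₁ e) ≟ p (Data.Product.proj₂ e))) es)

IsOPT : MultiGraph → ℕ → ℕ → Set
IsOPT G k w = (∃[ C ] weight G k C ≡ w) × (∀ (C : Cut G k) → w Data.Nat.≤ weight G k C)

ℕ→ℚ : ℕ → ℚ
ℕ→ℚ m = + m / 1

-- The algorithm finds OPT(G,k) by exhaustive search and then, at most k − 1
-- times, deletes the edges of a 2-cut of positive weight w with
-- (k − 1)·w < ε·OPT; so at most ε·OPT edges are deleted in total.
-- Recording the sides of the deleted cuts labels the vertices by a function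
-- that is constant on components and gains a new value in every round (the
-- deleted cut separates the endpoints of one of its edges, which had equal
-- labels). Hence after k − 1 rounds the remaining graph has at least k
-- components; otherwise the pruning stopped because every 2-cut of positive
-- weight w satisfies (k − 1)·w ≥ ε·OPT.
module Submission where

open import Defs
open import Data.Nat as ℕ using (ℕ; zero; suc; _+_; _∸_; _≤_; z≤n; s≤s)
import Data.Nat.Properties as ℕP
open import Data.Integer as ℤ using (+_)
import Data.Integer.Properties as ℤP
import Data.Nat.Coprimality as Coprime
open import Data.Rational using (ℚ; mkℚ; _*_; _<_; 0ℚ; 1ℚ; Positive; NonNegative)
import Data.Rational as ℚ
import Data.Rational.Properties as ℚP
open import Data.Fin as Fin using (Fin; zero; suc)
open import Data.Fin.Properties using (_≟_; any?; all?; pigeonhole)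
import Data.Vec.Functional as Vector
open import Data.List using (List; []; _∷_; length; filter; lookup)
open import Data.Nat.ListAction using (sum)
import Data.List.Properties as List
open import Data.List.Membership.Propositional using (_∈_; find; lose)
open import Data.List.Membership.Propositional.Properties using (∈-filter⁻; ∈-lookup)
open import Data.List.Relation.Unary.Any as Any using (here; there)
open import Data.List.Relation.Unary.All as All using (All)
open import Data.List.Relation.Unary.AllPairs as AllPairs using (AllPairs; _∷_)
open import Data.List.Relation.Binary.Sublist.Propositional using (_⊆_; ⊆-refl; ⊆-trans)
open import Data.List.Relation.Binary.Sublist.Propositional.Properties using (filter-⊆)
open import Data.Product as Product using (Σ; ∃; ∃₂; _×_; _,_; proj₁; proj₂)
open import Data.Sum as Sum using (_⊎_; inj₁; inj₂)
open import Data.Empty using (⊥-elim)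
open import Function using (_∘_; Equivalence)
open import Relation.Nullary using (¬_; Dec; yes; no; ¬?; _×-dec_; contradiction)
import Relation.Nullary.Decidable as Dec
open import Relation.Unary using (Decidable)
open import Relation.Binary.PropositionalEquality
open import Relation.Binary.Definitions using (DecidableEquality)
open import Relation.Binary.Construct.Closure.ReflexiveTransitive as Star using (_◅_)

Extensional : ∀ {n} {A : Set} → ((Fin n → A) → Set) → Set
Extensional P = ∀ {f g} → f ≗ g → P f → P g

any-function? : ∀ n {b} {P : (Fin n → Fin b) → Set} →
                Extensional P → Decidable P → Dec (∃ P)
any-function? zero {b} ext P? =
  Dec.map′ (λ p → empty , p) (λ (f , p) → ext (λ ()) p) (P? empty)
  where
  empty : Fin 0 → Fin b
  empty ()
any-function? (suc n) ext P? =
  Dec.map′ (λ (a , g , p) → a Vector.∷ g , p)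
           (λ (f , p) → f zero , f ∘ suc , ext (λ { zero → refl ; (suc i) → refl }) p)
           (any? λ a → any-function? n (λ g≗h → ext (λ { zero → refl ; (suc i) → g≗h i }))
                                        (P? ∘ (a Vector.∷_)))

firstFrom : {P : ℕ → Set} → Decidable P → ℕ → ℕ → ℕ
firstFrom P? s zero = s
firstFrom P? s (suc fuel) with P? s
... | yes _ = s
... | no _ = firstFrom P? (suc s) fuel

firstFrom-minimal : ∀ {P : ℕ → Set} (P? : Decidable P) s fuel {w} → s ≤ w → w ≤ s + fuel →
                    P w → P (firstFrom P? s fuel) × firstFrom P? s fuel ≤ w
firstFrom-minimal P? s zero s≤w w≤s+0 Pw
  rewrite ℕP.≤-antisym s≤w (subst (_ ≤_) (ℕP.+-identityʳ s) w≤s+0) = Pw , ℕP.≤-refl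
firstFrom-minimal P? s (suc fuel) {w} s≤w w≤ Pw with P? s
... | yes Ps = Ps , s≤w
... | no ¬Ps = firstFrom-minimal P? (suc s) fuel
                 (ℕP.≤∧≢⇒< s≤w (λ { refl → ¬Ps Pw }))
                 (subst (w ≤_) (ℕP.+-suc s fuel) w≤) Pw

Edges : ℕ → Set
Edges n = List (Fin n × Fin n)

module _ {n b : ℕ} (f : Fin n → Fin b) where

  cutSize : Edges n → ℕ
  cutSize E = length (filter (λ e → ¬? (f (proj₁ e) ≟ f (proj₂ e))) E)

  uncut : Edges n → Edges n
  uncut = filter (λ e → f (proj₁ e) ≟ f (proj₂ e))

  length≡uncut+cutSize : ∀ E → length E ≡ length (uncut E) + cutSize E
  length≡uncut+cutSize [] = refl
  length≡uncut+cutSize ((u , v) ∷ E) with f u ≟ f v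
  ... | yes _ = cong suc (length≡uncut+cutSize E)
  ... | no _ = trans (cong suc (length≡uncut+cutSize E)) (sym (ℕP.+-suc _ _))

  cutSize≤length : ∀ E → cutSize E ≤ length E
  cutSize≤length E = subst (cutSize E ≤_) (sym (length≡uncut+cutSize E)) (ℕP.m≤n+m _ _)

  cut-edge : ∀ E → 1 ≤ cutSize E → ∃₂ λ u v → (u , v) ∈ E × f u ≢ f v
  cut-edge ((u , v) ∷ E) nonzero with f u ≟ f v
  ... | no fu≢fv = u , v , here refl , fu≢fv
  ... | yes _ with u′ , v′ , uv∈E , fu′≢fv′ ← cut-edge E nonzero = u′ , v′ , there uv∈E , fu′≢fv′

  ∈-uncut⁻ : ∀ E {u v} → (u , v) ∈ uncut E → (u , v) ∈ E × f u ≡ f v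
  ∈-uncut⁻ E = ∈-filter⁻ (λ e → f (proj₁ e) ≟ f (proj₂ e)) {xs = E}

uncut-⊆ : ∀ {n b} (f : Fin n → Fin b) E → uncut f E ⊆ E
uncut-⊆ f = filter-⊆ (λ e → f (proj₁ e) ≟ f (proj₂ e))

cutSize-cong : ∀ {n b} {f g : Fin n → Fin b} → f ≗ g → ∀ E → cutSize f E ≡ cutSize g E
cutSize-cong {f = f} {g} f≗g E = cong length (List.filter-≐ _ _ (to , from) E)
  where
  to : ∀ {e} → f (proj₁ e) ≢ f (proj₂ e) → g (proj₁ e) ≢ g (proj₂ e)
  to {u , v} fu≢fv gu≡gv = fu≢fv (trans (f≗g u) (trans gu≡gv (sym (f≗g v))))
  from : ∀ {e} → g (proj₁ e) ≢ g (proj₂ e) → f (proj₁ e) ≢ f (proj₂ e)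
  from {u , v} gu≢gv fu≡fv = gu≢gv (trans (sym (f≗g u)) (trans fu≡fv (f≗g v)))

HasCutOfWeight : MultiGraph → ℕ → ℕ → Set
HasCutOfWeight G k w = ∃ λ (f : Fin (n G) → Fin k) → Surjective f × cutSize f (edges G) ≡ w

hasCutOfWeight? : ∀ G k → Decidable (HasCutOfWeight G k)
hasCutOfWeight? G k w = any-function? (n G) extensional
  (λ f → all? (λ j → any? (λ i → f i ≟ j)) ×-dec (cutSize f (edges G) ℕP.≟ w))
  where
  extensional : Extensional (λ f → Surjective f × cutSize f (edges G) ≡ w)
  extensional f≗g (onto , weight≡w) =
    (λ j → Product.map₂ (trans (sym (f≗g _))) (onto j)) ,
    trans (sym (cutSize-cong f≗g (edges G))) weight≡w

minCut : MultiGraph → ℕ → ℕ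
minCut G k = firstFrom (hasCutOfWeight? G k) 0 (length (edges G))

minCut-correct : ∀ G k {opt} → IsOPT G k opt → minCut G k ≡ opt
minCut-correct G k {opt} (((f₀ , onto₀) , weight≡opt) , minimal)
  with (f , onto , weight≡min) , min≤opt ←
       firstFrom-minimal (hasCutOfWeight? G k) 0 (length (edges G)) z≤n
         (subst (_≤ length (edges G)) weight≡opt (cutSize≤length f₀ (edges G)))
         (f₀ , onto₀ , weight≡opt)
  = ℕP.≤-antisym min≤opt (subst (opt ≤_) weight≡min (minimal (f , onto)))

module _ {V A : Set} where

  Distinct : (V → A) → List V → Set
  Distinct ℓ = AllPairs (λ a b → ℓ a ≢ ℓ b)

  distinct-injective : ∀ {ℓ : V → A} {S a b} → Distinct ℓ S → a ∈ S → b ∈ S → ℓ a ≡ ℓ b → a ≡ b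
  distinct-injective (_ ∷ _) (here refl) (here refl) _ = refl
  distinct-injective (h ∷ _) (here refl) (there b∈S) eq = contradiction eq (All.lookup h b∈S)
  distinct-injective (h ∷ _) (there a∈S) (here refl) eq = contradiction (sym eq) (All.lookup h a∈S)
  distinct-injective (_ ∷ d) (there a∈S) (there b∈S) eq = distinct-injective d a∈S b∈S eq

lookup-AllPairs : ∀ {A : Set} {R : A → A → Set} {xs} → AllPairs R xs →
                  ∀ {i j} → i Fin.< j → R (lookup xs i) (lookup xs j)
lookup-AllPairs (h ∷ _) {zero} {suc j} _ = All.lookup h (∈-lookup j)
lookup-AllPairs (_ ∷ hs) {suc i} {suc j} (s≤s i<j) = lookup-AllPairs hs i<j

distinct-length≤ : ∀ {V : Set} {m} (c : V → Fin m) {S} → Distinct c S → length S ≤ m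
distinct-length≤ {m = m} c {S} d with length S ℕP.≤? m
... | yes ≤m = ≤m
... | no ≰m with i , j , i<j , eq ← pigeonhole (ℕP.≰⇒> ≰m) (c ∘ lookup S) =
  contradiction eq (lookup-AllPairs d i<j)

distinct-∷ : ∀ {V B : Set} {ℓ : V → List B} (f : V → B) {S} →
             Distinct ℓ S → Distinct (λ x → f x ∷ ℓ x) S
distinct-∷ f = AllPairs.map (λ ℓa≢ℓb eq → ℓa≢ℓb (List.∷-injectiveʳ eq))

-- Since ℓ u ≡ ℓ v but f u ≢ f v, the refined labels of u and v cannot both
-- occur on S; take w to be one whose refined label is new.
refine-distinct : ∀ {V B : Set} → DecidableEquality B →
                  ∀ {ℓ : V → List B} (f : V → B) {S u v} →
                  Distinct ℓ S → ℓ u ≡ ℓ v → f u ≢ f v →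
                  ∃ λ w → Distinct (λ x → f x ∷ ℓ x) (w ∷ S)
refine-distinct _≟ᴮ_ {ℓ} f {S} {u} {v} d ℓu≡ℓv fu≢fv
  with Any.any? (λ s → List.≡-dec _≟ᴮ_ (f s ∷ ℓ s) (f u ∷ ℓ u)) S
... | no u-fresh =
  u , All.tabulate (λ s∈S eq → u-fresh (lose s∈S (sym eq))) ∷ distinct-∷ f d
... | yes u-taken =
  v , All.tabulate (λ s∈S ℓ′v≡ℓ′s → fu≢fv (v-taken⇒fu≡fv (find u-taken) s∈S ℓ′v≡ℓ′s))
      ∷ distinct-∷ f d
  where
  v-taken⇒fu≡fv : ∀ {s} → (∃ λ s₀ → s₀ ∈ S × f s₀ ∷ ℓ s₀ ≡ f u ∷ ℓ u) →
                  s ∈ S → f v ∷ ℓ v ≡ f s ∷ ℓ s → f u ≡ f v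
  v-taken⇒fu≡fv (s₀ , s₀∈S , ℓ′s₀≡ℓ′u) s∈S ℓ′v≡ℓ′s
    with refl ← distinct-injective d s₀∈S s∈S
                  (trans (List.∷-injectiveʳ ℓ′s₀≡ℓ′u) (trans ℓu≡ℓv (List.∷-injectiveʳ ℓ′v≡ℓ′s)))
    = trans (sym (List.∷-injectiveˡ ℓ′s₀≡ℓ′u)) (sym (List.∷-injectiveˡ ℓ′v≡ℓ′s))

Respects : ∀ {n} {A : Set} → (Fin n → A) → Edges n → Set
Respects ℓ E = ∀ {u v} → (u , v) ∈ E → ℓ u ≡ ℓ v

respects-connected : ∀ {n A} {ℓ : Fin n → A} {E} → Respects ℓ E →
                     ∀ {a b} → Connected (graph n E) a b → ℓ a ≡ ℓ b
respects-connected resp Star.ε = refl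
respects-connected resp (fwd uv∈E ◅ path) = trans (resp uv∈E) (respects-connected resp path)
respects-connected resp (bwd uv∈E ◅ path) = trans (sym (resp uv∈E)) (respects-connected resp path)

-- Certifies that the graph on E has at least m components.
ManyComponents : ∀ {n} → ℕ → Edges n → Set
ManyComponents {n} m E =
  ∃₂ λ (ℓ : Fin n → List (Fin 2)) S → Respects ℓ E × length S ≡ m × Distinct ℓ S

manyComponents-1 : ∀ {n} {E : Edges n} → Fin n → ManyComponents 1 E
manyComponents-1 v = (λ _ → []) , v ∷ [] , (λ _ → refl) , refl , All.[] ∷ AllPairs.[]

manyComponents-uncut : ∀ {n m} {E : Edges n} (f : Fin n → Fin 2) → 1 ≤ cutSize f E →
                       ManyComponents m E → ManyComponents (suc m) (uncut f E)
manyComponents-uncut {E = E} f nonzero (ℓ , S , resp , refl , d)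
  with u , v , uv∈E , fu≢fv ← cut-edge f E nonzero
  with w , d′ ← refine-distinct _≟_ f d (resp uv∈E) fu≢fv
  = (λ x → f x ∷ ℓ x) , w ∷ S , resp′ , refl , d′
  where
  resp′ : Respects (λ x → f x ∷ ℓ x) (uncut f E)
  resp′ uv∈ with uv∈E , fu≡fv ← ∈-uncut⁻ f E uv∈ = cong₂ _∷_ fu≡fv (resp uv∈E)

manyComponents⇒¬CCLess : ∀ {n m k} {E : Edges n} → ManyComponents m E → k ≤ m →
                         ¬ CCLess (graph n E) k
manyComponents⇒¬CCLess (ℓ , S , resp , refl , d) k≤m (m′ , (c , _ , sameComponent) , m′<k) =
  ℕP.<⇒≱ (ℕP.<-≤-trans m′<k k≤m) (distinct-length≤ c (AllPairs.map separate d))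
  where
  separate : ∀ {a b} → ℓ a ≢ ℓ b → c a ≢ c b
  separate ℓa≢ℓb ca≡cb = ℓa≢ℓb (respects-connected resp (Equivalence.to (sameComponent _ _) ca≡cb))

ℕ→ℚ-mkℚ : ∀ a → ℕ→ℚ a ≡ mkℚ (+ a) 0 (Coprime.sym (Coprime.1-coprimeTo a))
ℕ→ℚ-mkℚ a = ℚP.normalize-coprime (Coprime.sym (Coprime.1-coprimeTo a))

ℕ→ℚ-+ : ∀ a b → ℕ→ℚ (a + b) ≡ ℕ→ℚ a ℚ.+ ℕ→ℚ b
ℕ→ℚ-+ a b rewrite ℕ→ℚ-mkℚ a | ℕ→ℚ-mkℚ b =
  sym (cong₂ (λ x y → (x ℤ.+ y) ℚ./ 1) (ℤP.*-identityʳ (+ a)) (ℤP.*-identityʳ (+ b)))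

ℕ→ℚ-mono-≤ : ∀ {a b} → a ≤ b → ℕ→ℚ a ℚ.≤ ℕ→ℚ b
ℕ→ℚ-mono-≤ {a} {b} a≤b rewrite ℕ→ℚ-mkℚ a | ℕ→ℚ-mkℚ b =
  ℚ.*≤* (subst₂ ℤ._≤_ (sym (ℤP.*-identityʳ (+ a))) (sym (ℤP.*-identityʳ (+ b))) (ℤ.+≤+ a≤b))

ℕ→ℚ-nonNeg : ∀ a → NonNegative (ℕ→ℚ a)
ℕ→ℚ-nonNeg a = ℚ.nonNegative (ℕ→ℚ-mono-≤ {0} {a} z≤n)

ℕ→ℚ-pos : ∀ a → Positive (ℕ→ℚ (suc a))
ℕ→ℚ-pos a rewrite ℕ→ℚ-mkℚ (suc a) = _

*-sum-≤ : ∀ {K X : ℚ} {ws} → All (λ w → K * ℕ→ℚ w < X) ws →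
          K * ℕ→ℚ (sum ws) ℚ.≤ ℕ→ℚ (length ws) * X
*-sum-≤ {K} {X} All.[] = ℚP.≤-reflexive (trans (ℚP.*-zeroʳ K) (sym (ℚP.*-zeroˡ X)))
*-sum-≤ {K} {X} {w ∷ ws} (Kw<X All.∷ rest) = begin
  K * ℕ→ℚ (w + sum ws)                 ≡⟨ cong (K *_) (ℕ→ℚ-+ w (sum ws)) ⟩
  K * (ℕ→ℚ w ℚ.+ ℕ→ℚ (sum ws))         ≡⟨ ℚP.*-distribˡ-+ K (ℕ→ℚ w) (ℕ→ℚ (sum ws)) ⟩
  K * ℕ→ℚ w ℚ.+ K * ℕ→ℚ (sum ws)       ≤⟨ ℚP.+-mono-≤ (ℚP.<⇒≤ Kw<X) (*-sum-≤ {K} {X} rest) ⟩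
  X ℚ.+ ℕ→ℚ (length ws) * X            ≡⟨ cong (ℚ._+ ℕ→ℚ (length ws) * X) (ℚP.*-identityˡ X) ⟨
  1ℚ * X ℚ.+ ℕ→ℚ (length ws) * X       ≡⟨ ℚP.*-distribʳ-+ X 1ℚ (ℕ→ℚ (length ws)) ⟨
  (1ℚ ℚ.+ ℕ→ℚ (length ws)) * X         ≡⟨ cong (_* X) (ℕ→ℚ-+ 1 (length ws)) ⟨
  ℕ→ℚ (suc (length ws)) * X            ∎
  where open ℚP.≤-Reasoning

sum-≤ : ∀ {K} {X : ℚ} {ws} → 0ℚ ℚ.≤ X → All (λ w → ℕ→ℚ K * ℕ→ℚ w < X) ws →
        length ws ≤ K → ℕ→ℚ (sum ws) ℚ.≤ X
sum-≤ 0≤X All.[] _ = 0≤X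
sum-≤ {zero} _ (_ All.∷ _) ()
sum-≤ {suc K} {X} 0≤X small@(_ All.∷ _) length≤K =
  ℚP.*-cancelˡ-≤-pos (ℕ→ℚ (suc K)) {{ℕ→ℚ-pos K}}
    (ℚP.≤-trans (*-sum-≤ {ℕ→ℚ (suc K)} {X} small)
                (ℚP.*-monoʳ-≤-nonNeg X {{ℚ.nonNegative 0≤X}} (ℕ→ℚ-mono-≤ length≤K)))

-- Small is kept abstract because with-abstraction over light? normalises the
-- goal, and the normal form of ℕ→ℚ on an open term unfolds gcd and explodes;
-- for the same reason LightCutPruning avoids with.
module Pruning {n : ℕ} {Small : ℕ → Set} (small? : Decidable Small) where

  Light : Edges n → (Fin n → Fin 2) → Set
  Light E f = 1 ≤ cutSize f E × Small (cutSize f E)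

  light? : ∀ E → Dec (∃ (Light E))
  light? E = any-function? n extensional
    (λ f → (1 ℕP.≤? cutSize f E) ×-dec small? (cutSize f E))
    where
    extensional : Extensional (Light E)
    extensional f≗g = subst (λ w → 1 ≤ w × Small w) (cutSize-cong f≗g E)

  prune : ℕ → Edges n → ℕ × Edges n
  prune zero E = 0 , E
  prune (suc r) E with light? E
  ... | yes (f , _) = Product.map₁ suc (prune r (uncut f E))
  ... | no _ = 0 , E

  rounds : ℕ → Edges n → ℕ
  rounds r E = proj₁ (prune r E)

  pruned : ℕ → Edges n → Edges n
  pruned r E = proj₂ (prune r E)

  pruned-⊆ : ∀ r E → pruned r E ⊆ E
  pruned-⊆ zero E = ⊆-refl
  pruned-⊆ (suc r) E with light? E
  ... | yes (f , _) = ⊆-trans (pruned-⊆ r (uncut f E)) (uncut-⊆ f E)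
  ... | no _ = ⊆-refl

  rounds≤ : ∀ r E → rounds r E ≤ r
  rounds≤ zero E = z≤n
  rounds≤ (suc r) E with light? E
  ... | yes (f , _) = s≤s (rounds≤ r (uncut f E))
  ... | no _ = z≤n

  pruned-deleted : ∀ r E → ∃ λ ws → All Small ws × length ws ≡ rounds r E ×
                                    length E ≡ sum ws + length (pruned r E)
  pruned-deleted zero E = [] , All.[] , refl , refl
  pruned-deleted (suc r) E with light? E
  ... | no _ = [] , All.[] , refl , refl
  ... | yes (f , _ , small)
    with ws , smalls , length≡rounds , length≡ ← pruned-deleted r (uncut f E) =
    cutSize f E ∷ ws , small All.∷ smalls , cong suc length≡rounds ,
    (begin
      length E                                        ≡⟨ length≡uncut+cutSize f E ⟩
      length (uncut f E) + cutSize f E                ≡⟨ ℕP.+-comm _ (cutSize f E) ⟩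
      cutSize f E + length (uncut f E)                ≡⟨ cong (ℕ._+_ (cutSize f E)) length≡ ⟩
      cutSize f E + (sum ws + length (pruned r (uncut f E)))
                                                      ≡⟨ ℕP.+-assoc (cutSize f E) (sum ws) _ ⟨
      cutSize f E + sum ws + length (pruned r (uncut f E)) ∎)
    where open ≡-Reasoning

  pruned-stuck : ∀ r E → rounds r E ≡ r ⊎ ¬ ∃ (Light (pruned r E))
  pruned-stuck zero E = inj₁ refl
  pruned-stuck (suc r) E with light? E
  ... | yes (f , _) = Sum.map₁ (cong suc) (pruned-stuck r (uncut f E))
  ... | no none = inj₂ none

  pruned-manyComponents : ∀ r E {m} → ManyComponents m E →
                          ManyComponents (rounds r E + m) (pruned r E)
  pruned-manyComponents zero E many = many
  pruned-manyComponents (suc r) E {m} many with light? E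
  ... | yes (f , nonzero , _) =
    subst (λ j → ManyComponents {n} j (pruned r (uncut f E)))
          (ℕP.+-suc (rounds r (uncut f E)) m)
      (pruned-manyComponents r (uncut f E) (manyComponents-uncut f nonzero many))
  ... | no _ = many

module LightCutPruning {n : ℕ} (r : ℕ) (X : ℚ) where

  open Pruning {n} (λ w → ℕ→ℚ r * ℕ→ℚ w ℚP.<? X) public

  pruned-deleted-≤ : 0ℚ ℚ.≤ X → ∀ E → ℕ→ℚ (length E ∸ length (pruned r E)) ℚ.≤ X
  pruned-deleted-≤ 0≤X E =
    let ws , smalls , length≡rounds , length≡ = pruned-deleted r E
        deleted≡sum = trans (cong (_∸ length (pruned r E)) length≡)
                            (ℕP.m+n∸n≡m (sum ws) (length (pruned r E)))
    in subst (λ D → ℕ→ℚ D ℚ.≤ X) (sym deleted≡sum)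
         (sum-≤ 0≤X smalls (subst (_≤ r) (sym length≡rounds) (rounds≤ r E)))

  pruned-cuts-heavy : ∀ E → CCLess (graph n (pruned r E)) (suc r) →
                      ∀ f → 1 ≤ cutSize f (pruned r E) →
                      X ℚ.≤ ℕ→ℚ r * ℕ→ℚ (cutSize f (pruned r E))
  pruned-cuts-heavy E ccLess f nonzero = Sum.[ exhausted⇒heavy , stuck⇒heavy ]′ (pruned-stuck r E)
    where
    stuck⇒heavy : ¬ ∃ (Light (pruned r E)) → X ℚ.≤ ℕ→ℚ r * ℕ→ℚ (cutSize f (pruned r E))
    stuck⇒heavy none = ℚP.≮⇒≥ (λ light → none (f , nonzero , light))
    exhausted⇒heavy : rounds r E ≡ r → X ℚ.≤ ℕ→ℚ r * ℕ→ℚ (cutSize f (pruned r E))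
    exhausted⇒heavy exhausted = ⊥-elim
      (manyComponents⇒¬CCLess
        (pruned-manyComponents r E (manyComponents-1 (proj₁ (cut-edge f (pruned r E) nonzero))))
        (ℕP.≤-reflexive (trans (ℕP.+-comm 1 r) (cong (_+ 1) (sym exhausted)))) ccLess)

ccLess-mono : ∀ {G k k′} → k ≤ k′ → CCLess G k → CCLess G k′
ccLess-mono k≤k′ (m , hasCC , m<k) = m , hasCC , ℕP.<-≤-trans m<k k≤k′

*ℕ→ℚ-nonNeg : ∀ {ε} a → 0ℚ ℚ.≤ ε → 0ℚ ℚ.≤ ε * ℕ→ℚ a
*ℕ→ℚ-nonNeg {ε} a 0≤ε = subst (ℚ._≤ ε * ℕ→ℚ a) (ℚP.*-zeroˡ (ℕ→ℚ a))
  (ℚP.*-monoʳ-≤-nonNeg (ℕ→ℚ a) {{ℕ→ℚ-nonNeg a}} 0≤ε)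

*ℕ→ℚ-≤-double : ∀ {ε} a → 0ℚ ℚ.≤ ε → ε * ℕ→ℚ a ℚ.≤ (ℕ→ℚ 2 * ε) * ℕ→ℚ a
*ℕ→ℚ-≤-double {ε} a 0≤ε = ℚP.*-monoʳ-≤-nonNeg (ℕ→ℚ a) {{ℕ→ℚ-nonNeg a}}
  (subst (ℚ._≤ ℕ→ℚ 2 * ε) (ℚP.*-identityˡ ε)
     (ℚP.*-monoʳ-≤-nonNeg ε {{ℚ.nonNegative 0≤ε}} (ℕ→ℚ-mono-≤ {1} {2} (s≤s z≤n))))

pruneLightCuts : (k : ℕ) → (G : MultiGraph) → ℚ → Edges (n G)
pruneLightCuts k G ε = LightCutPruning.pruned (k ∸ 1) (ε * ℕ→ℚ (minCut G k)) (k ∸ 1) (edges G)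

lemma3p1 : Σ ((k : ℕ) → (G : MultiGraph) → ℚ → List (Fin (n G) × Fin (n G))) λ alg →
    (k : ℕ) → 1 ≤ k → (G : MultiGraph) → CCLess G k →
    (ε : ℚ) → 0ℚ < ε → ε Data.Rational.≤ 1ℚ →
    let E₁ = alg k G ε
        G₁ = graph (n G) E₁
    in (E₁ ⊆ edges G)
     × ((opt : ℕ) → IsOPT G k opt →
          (ℕ→ℚ (length (edges G) ∸ length E₁) Data.Rational.≤ (ℕ→ℚ 2 * ε) * ℕ→ℚ opt)
        × (CCLess G₁ k →
             (C : Cut G₁ 2) → 1 ≤ weight G₁ 2 C →
             ε * ℕ→ℚ opt Data.Rational.≤ ℕ→ℚ (k ∸ 1) * ℕ→ℚ (weight G₁ 2 C)))
lemma3p1 = pruneLightCuts , λ k _ G _ ε 0<ε _ →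
  let open LightCutPruning (k ∸ 1) (ε * ℕ→ℚ (minCut G k))
      0≤ε = ℚP.<⇒≤ 0<ε
  in pruned-⊆ (k ∸ 1) (edges G) ,
     λ opt isOpt →
       let ℕ→ℚ-minCut≡ = cong ℕ→ℚ (minCut-correct G k isOpt)
       in ℚP.≤-trans (pruned-deleted-≤ (*ℕ→ℚ-nonNeg (minCut G k) 0≤ε) (edges G))
            (ℚP.≤-trans (*ℕ→ℚ-≤-double (minCut G k) 0≤ε)
               (ℚP.≤-reflexive (cong ((ℕ→ℚ 2 * ε) *_) ℕ→ℚ-minCut≡))) ,
          λ ccLess (f , _) nonzero →
            ℚP.≤-trans (ℚP.≤-reflexive (cong (ε *_) (sym ℕ→ℚ-minCut≡)))
              (pruned-cuts-heavy (edges G) (ccLess-mono (ℕP.m≤n+m∸n k 1) ccLess) f nonzero)
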